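{- Let $G$ be a graph with $V(G)=V_1\cup\dots\cup V_t$, where $G[V_i]$ is a retract of $G$ for every $i\in[t]$, and let $k_1,\dots,k_t$ be nonnegative integers with $k=\sum_{i\in[t]}k_i$. Then $\mathrm{capt}_k(G)\le \max_{i\in[t]}\mathrm{capt}_{k_i}(G[V_i])$, where by convention $\mathrm{capt}_{k_i}(G[V_i])=\infty$ if $k_i<c(G[V_i])$.
   Context: Graphs are finite, undirected and reflexive. A retract of $G$ is an induced subgraph $H$ with a graph homomorphism $G\to H$ restricting to the identity on $H$. The game of Cops and Robbers: cops choose starting vertices (round 0), then the robber; players alternate, cops (any subset) moving to adjacent vertices or staying put, then the robber moving or staying; cops win by occupying the robber's vertex. $c(G)$ is the least number of cops with a winning strategy. For $k\ge c(G)$, $\mathrm{capt}_k(G)$ is the minimum over $k$-cop strategies of the number of rounds (excluding round 0) until capture against an optimally evading robber. -}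

module Defs where

open import Data.Nat using (ℕ; zero; suc; _+_)
open import Data.Fin using (Fin; zero; suc)
open import Data.Fin.Subset using (Subset; _∈_)
open import Data.Product using (Σ; ∃; _×_; _,_)
open import Data.Sum using (_⊎_)
open import Relation.Binary.PropositionalEquality using (_≡_)

record Graph (n : ℕ) : Set₁ where
  field
    Adj     : Fin n → Fin n → Set
    adj-refl : ∀ v → Adj v v
    adj-sym  : ∀ u v → Adj u v → Adj v u
open Graph public

sumFin : ∀ {t} → (Fin t → ℕ) → ℕ
sumFin {zero}  f = 0
sumFin {suc t} f = f zero + sumFin (λ i → f (suc i))

IsRetract : ∀ {n} → Graph n → Subset n → Set
IsRetract {n} G S =
  Σ (Fin n → Fin n) λ f →
    (∀ v → f v ∈ S) ×
    (∀ u v → Adj G u v → Adj G (f u) (f v)) ×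
    (∀ v → v ∈ S → f v ≡ v)

Caught : ∀ {n k} → (Fin k → Fin n) → Fin n → Set
Caught {k = k} C r = ∃ λ (j : Fin k) → C j ≡ r

-- A legal cop move in G[S] (each cop moves to an adjacent vertex of S
-- or stays put; graph is reflexive).
CopMove : ∀ {n k} → Graph n → Subset n → (Fin k → Fin n) → (Fin k → Fin n) → Set
CopMove G S C C' = ∀ j → C' j ∈ S × Adj G (C j) (C' j)

-- CopsWinIn G S m C r : it is the cops' turn, cops are at C, robber at r
-- (all in S); the cops can force capture within at most m further rounds.
CopsWinIn : ∀ {n k} → Graph n → Subset n → ℕ → (Fin k → Fin n) → Fin n → Set
CopsWinIn G S zero    C r = Caught C r
CopsWinIn {n} {k} G S (suc m) C r =
  Σ (Fin k → Fin n) λ C' → CopMove G S C C' ×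
    (Caught C' r ⊎
     (∀ r' → r' ∈ S → Adj G r r' → CopsWinIn G S m C' r'))

-- capt_k(G[S]) ≤ m : k cops have a strategy on G[S] capturing the robber
-- within m rounds (round 0 excluded) against every robber play.
-- (In particular k ≥ c(G[S]); if k < c(G[S]) this fails for all m,
-- matching the convention capt_k = ∞.)
CaptLe : ∀ {n} → Graph n → Subset n → ℕ → ℕ → Set
CaptLe {n} G S k m =
  Σ (Fin k → Fin n) λ C₀ → (∀ j → C₀ j ∈ S) ×
    (∀ r₀ → r₀ ∈ S → CopsWinIn G S m C₀ r₀)

-- Team i of ks i cops plays its optimal strategy on G[V i] against the
-- shadow ρᵢ(r) of the robber under the retraction ρᵢ : G → G[V i]. Since ρᵢ
-- is a homomorphism, every robber move induces a legal shadow move, so each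
-- team catches its shadow within m rounds and can stay on it afterwards.
-- The robber lies in some V i, where his shadow is himself, so once every
-- team holds its shadow the robber is caught.
module Submission where

open import Defs
open import Data.Nat using (ℕ; zero; suc)
open import Data.Fin using (Fin; zero; suc; _↑ˡ_; _↑ʳ_; _≟_)
open import Data.Fin.Subset using (Subset; _∈_; ⊤)
open import Data.Fin.Subset.Properties using (∈⊤)
open import Data.Product using (Σ; ∃; _×_; _,_; proj₁; proj₂)
open import Data.Sum using (inj₁; inj₂)
open import Data.Vec.Functional using (Vector; []; _++_)
open import Data.Vec.Functional.Properties using (lookup-++ˡ; lookup-++ʳ)
open import Data.Vec.Functional.Relation.Binary.Pointwise using (Pointwise)
import Data.Vec.Functional.Relation.Binary.Pointwise.Properties as Pointwise
open import Data.Vec.Functional.Relation.Unary.Any using (Any)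
open import Relation.Binary.PropositionalEquality using (_≡_; refl; sym; trans; subst)
open import Relation.Nullary using (yes; no; contradiction)

concatTeams : ∀ {a} {A : Set a} {t} {ks : Fin t → ℕ} →
  ((i : Fin t) → Vector A (ks i)) → Vector A (sumFin ks)
concatTeams {t = zero}  C = []
concatTeams {t = suc t} C = C zero ++ concatTeams (λ i → C (suc i))

concatTeams-pointwise : ∀ {a b r} {A : Set a} {B : Set b} {t} {ks : Fin t → ℕ}
  (R : A → B → Set r) {C : (i : Fin t) → Vector A (ks i)} {D : (i : Fin t) → Vector B (ks i)} →
  (∀ i → Pointwise R (C i) (D i)) → Pointwise R (concatTeams C) (concatTeams D)
concatTeams-pointwise {t = zero}  R rs ()
concatTeams-pointwise {t = suc t} R rs =
  Pointwise.++⁺ R (rs zero) (concatTeams-pointwise R (λ i → rs (suc i)))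

concatTeams-any : ∀ {a p} {A : Set a} {t} {ks : Fin t → ℕ} (P : A → Set p)
  (C : (i : Fin t) → Vector A (ks i)) → ∀ i → Any P (C i) → Any P (concatTeams C)
concatTeams-any P C zero (j , pj) =
  j ↑ˡ _ , subst P (sym (lookup-++ˡ (C zero) _ j)) pj
concatTeams-any {ks = ks} P C (suc i) any with concatTeams-any P (λ i → C (suc i)) i any
... | j , pj = ks zero ↑ʳ j , subst P (sym (lookup-++ʳ (C zero) _ j)) pj

module _ {n} (G : Graph n) (S : Subset n) where

  -- The cops have just moved to C and the robber, at s, is to move.
  CopsWinAfterMove : ∀ {k} → ℕ → (Fin k → Fin n) → Fin n → Set
  CopsWinAfterMove zero    C s = Caught C s
  CopsWinAfterMove (suc m) C s = ∀ s′ → s′ ∈ S → Adj G s s′ → CopsWinIn G S (suc m) C s′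

  -- The cop on the robber follows him; the others stay put.
  caught⇒CopsWinIn-suc : ∀ {k m} {C : Fin k → Fin n} {s s′} →
    (∀ j → C j ∈ S) → Caught C s → s′ ∈ S → Adj G s s′ → CopsWinIn G S (suc m) C s′
  caught⇒CopsWinIn-suc {k} {C = C} {s} {s′} C∈S (j , Cj≡s) s′∈S s~s′ = C′ , move , inj₁ (j , C′j≡s′)
    where
    C′ : Fin k → Fin n
    C′ j′ with C j′ ≟ s
    ... | yes _ = s′
    ... | no  _ = C j′

    move : CopMove G S C C′
    move j′ with C j′ ≟ s
    ... | yes refl = s′∈S , s~s′
    ... | no  _    = C∈S j′ , adj-refl G (C j′)

    C′j≡s′ : C′ j ≡ s′
    C′j≡s′ with C j ≟ s
    ... | yes _    = refl
    ... | no  Cj≢s = contradiction Cj≡s Cj≢s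

  CopsWinIn-suc⇒reply : ∀ {k m} {C : Fin k → Fin n} {s} → s ∈ S → CopsWinIn G S (suc m) C s →
    Σ (Fin k → Fin n) λ C′ → CopMove G S C C′ × CopsWinAfterMove m C′ s
  CopsWinIn-suc⇒reply {m = zero} s∈S (C′ , move , inj₁ caught) = C′ , move , caught
  CopsWinIn-suc⇒reply {m = zero} {s = s} s∈S (C′ , move , inj₂ win) =
    C′ , move , win s s∈S (adj-refl G s)
  CopsWinIn-suc⇒reply {m = suc m} s∈S (C′ , move , inj₁ caught) =
    C′ , move , λ s′ → caught⇒CopsWinIn-suc (λ j → proj₁ (move j)) caught
  CopsWinIn-suc⇒reply {m = suc m} s∈S (C′ , move , inj₂ win) = C′ , move , win

  reply⇒CopsWinIn-suc : ∀ {k m} {C C′ : Fin k → Fin n} {s} →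
    CopMove G S C C′ → CopsWinAfterMove m C′ s → CopsWinIn G S (suc m) C s
  reply⇒CopsWinIn-suc {m = zero}  {C′ = C′} move caught = C′ , move , inj₁ caught
  reply⇒CopsWinIn-suc {m = suc m} {C′ = C′} move win    = C′ , move , inj₂ win

module Shadowing {n t} (G : Graph n) (V : Fin t → Subset n) (ks : Fin t → ℕ)
  (cover : ∀ v → ∃ λ i → v ∈ V i) (retract : ∀ i → IsRetract G (V i)) where

  Teams : Set
  Teams = (i : Fin t) → Fin (ks i) → Fin n

  ρ : Fin t → Fin n → Fin n
  ρ i = proj₁ (retract i)

  ρ-∈ : ∀ i v → ρ i v ∈ V i
  ρ-∈ i = proj₁ (proj₂ (retract i))

  ρ-hom : ∀ i {u v} → Adj G u v → Adj G (ρ i u) (ρ i v)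
  ρ-hom i = proj₁ (proj₂ (proj₂ (retract i))) _ _

  ρ-fix : ∀ i {v} → v ∈ V i → ρ i v ≡ v
  ρ-fix i = proj₂ (proj₂ (proj₂ (retract i))) _

  shadowsCaught⇒caught : (C : Teams) (r : Fin n) →
    (∀ i → Caught (C i) (ρ i r)) → Caught (concatTeams C) r
  shadowsCaught⇒caught C r caught with cover r
  ... | i , r∈Vi with caught i
  ... | j , Cij≡ρr = concatTeams-any (_≡ r) C i (j , trans Cij≡ρr (ρ-fix i r∈Vi))

  shadowsWinIn⇒CopsWinIn : ∀ m (C : Teams) r →
    (∀ i → CopsWinIn G (V i) m (C i) (ρ i r)) → CopsWinIn G ⊤ m (concatTeams C) r

  shadowsWinAfterMove⇒CopsWinAfterMove : ∀ m (C : Teams) r →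
    (∀ i → CopsWinAfterMove G (V i) m (C i) (ρ i r)) → CopsWinAfterMove G ⊤ m (concatTeams C) r
  shadowsWinAfterMove⇒CopsWinAfterMove zero    C r caught = shadowsCaught⇒caught C r caught
  shadowsWinAfterMove⇒CopsWinAfterMove (suc m) C r win r′ _ r~r′ =
    shadowsWinIn⇒CopsWinIn (suc m) C r′ (λ i → win i (ρ i r′) (ρ-∈ i r′) (ρ-hom i r~r′))

  shadowsWinIn⇒CopsWinIn zero    C r caught = shadowsCaught⇒caught C r caught
  shadowsWinIn⇒CopsWinIn (suc m) C r win =
    reply⇒CopsWinIn-suc G ⊤ (λ j → ∈⊤ , adjacent j)
      (shadowsWinAfterMove⇒CopsWinAfterMove m C′ r (λ i → proj₂ (proj₂ (reply i))))
    where
    reply : ∀ i → Σ (Fin (ks i) → Fin n) λ C′ →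
      CopMove G (V i) (C i) C′ × CopsWinAfterMove G (V i) m C′ (ρ i r)
    reply i = CopsWinIn-suc⇒reply G (V i) (ρ-∈ i r) (win i)

    C′ : Teams
    C′ i = proj₁ (reply i)

    adjacent : Pointwise (Adj G) (concatTeams C) (concatTeams C′)
    adjacent = concatTeams-pointwise (Adj G) (λ i j → proj₂ (proj₁ (proj₂ (reply i)) j))

theorem2p5 : ∀ {n t} (G : Graph n) (V : Fin t → Subset n) (ks : Fin t → ℕ) →
    (∀ v → ∃ λ i → v ∈ V i) →
    (∀ i → IsRetract G (V i)) →
    ∀ (m : ℕ) → (∀ i → CaptLe G (V i) (ks i) m) →
    CaptLe G ⊤ (sumFin ks) m
theorem2p5 G V ks cover retract m capt =
  concatTeams C₀ , (λ _ → ∈⊤) , λ r₀ _ →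
    shadowsWinIn⇒CopsWinIn m C₀ r₀ (λ i → proj₂ (proj₂ (capt i)) (ρ i r₀) (ρ-∈ i r₀))
  where
  open Shadowing G V ks cover retract
  C₀ : Teams
  C₀ i = proj₁ (capt i)
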